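{- For all integers $1\le\delta<\Delta$, there is a unique graph up to isomorphism in $\mathcal{H}_{\delta,\Delta}$, namely the graph $H_{\delta,\Delta}$ obtained from a complete graph on vertices $v_1,\dots,v_\Delta$ by adding a vertex $w$ and the edges $v_iw$ for $1\le i\le\delta$.
   Context: All graphs are finite and simple. For $1\le\delta<\Delta$, $\mathcal{H}_{\delta,\Delta}$ is the family of graphs with $\Delta+1$ vertices, one of which has degree $\delta$, $\delta$ of which have degree $\Delta$, and the remaining $\Delta-\delta$ of which have degree $\Delta-1$. -}

module Defs where

open import Data.Nat using (ℕ; zero; suc; _+_; _∸_; _<ᵇ_; _≡ᵇ_)
open import Data.Bool using (Bool; true; false; _∧_; _∨_; not; if_then_else_)
open import Data.Fin using (Fin; toℕ)
open import Data.List using (List; map; allFin)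
open import Data.Nat.ListAction using (sum)
open import Data.Product using (Σ; _×_)
open import Relation.Binary.PropositionalEquality using (_≡_; _≢_)
open import Function.Bundles using (_↔_; Inverse)

Graph : ℕ → Set
Graph n = Fin n → Fin n → Bool

Simple : {n : ℕ} → Graph n → Set
Simple {n} G = ((i j : Fin n) → G i j ≡ G j i) × ((i : Fin n) → G i i ≡ false)

count : {n : ℕ} → (Fin n → Bool) → ℕ
count {n} p = sum (map (λ i → if p i then 1 else 0) (allFin n))

degree : {n : ℕ} → Graph n → Fin n → ℕ
degree G i = count (G i)

_≅_ : {n : ℕ} → Graph n → Graph n → Set
_≅_ {n} G H = Σ (Fin n ↔ Fin n) λ σ →
  (i j : Fin n) → H (Inverse.to σ i) (Inverse.to σ j) ≡ G i j

In-ℋ : (δ Δ : ℕ) → Graph (suc Δ) → Set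
In-ℋ δ Δ G = Σ (Fin (suc Δ)) λ w →
    (degree G w ≡ δ)
  × (count (λ v → degree G v ≡ᵇ Δ) ≡ δ)
  × (count (λ v → not (toℕ v ≡ᵇ toℕ w) ∧ (degree G v ≡ᵇ (Δ ∸ 1))) ≡ Δ ∸ δ)

-- The graph H_{δ,Δ} on vertices Fin (suc Δ): vertices 0..Δ-1 are v_1..v_Δ
-- (forming a clique), vertex Δ is w, adjacent exactly to v_1..v_δ
-- (the vertices with index < δ).
H-graph : (δ Δ : ℕ) → Graph (suc Δ)
H-graph δ Δ i j = not (a ≡ᵇ b) ∧
    ((((a <ᵇ Δ) ∧ (b <ᵇ Δ)) ∨ ((a ≡ᵇ Δ) ∧ (b <ᵇ δ))) ∨ ((b ≡ᵇ Δ) ∧ (a <ᵇ δ)))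
  where
    a = toℕ i
    b = toℕ j

-- A vertex of degree Δ in a graph on Δ + 1 vertices is adjacent to every other vertex.  Hence
-- w is adjacent to all δ vertices of degree Δ, and since deg w = δ these are all its neighbours.
-- The remaining Δ − δ vertices are not adjacent to w; there are exactly as many of them as
-- vertices of degree Δ − 1 other than w, so each has degree Δ − 1 and is adjacent to everything
-- but w.  Thus every vertex has one of three roles (degree Δ, degree Δ − 1, or w), adjacency
-- depends only on the roles, and the roles occur δ, Δ − δ and 1 times.  H_{δ,Δ} is described by
-- the same roles, so a role-preserving bijection is an isomorphism onto it; the degrees of
-- H_{δ,Δ} are read off from the same description.
module Submission where

open import Defs
open import Algebra.Properties.CommutativeSemigroup using (x∙yz≈y∙xz)
open import Data.Bool using (Bool; true; false; not; _∧_; _∨_; if_then_else_)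
open import Data.Bool.Properties using (∨-identityʳ)
open import Data.Empty using (⊥-elim)
open import Data.Fin using (Fin; zero; suc; toℕ; fromℕ; punchIn; punchOut)
open import Data.Fin.Permutation as Permutation using (Permutation′; _⟨$⟩ʳ_; insert; insert-punchIn)
open import Data.Fin.Properties using (_≟_; punchInᵢ≢i; punchIn-punchOut; toℕ-fromℕ; toℕ≤pred[n])
open import Data.List using (tabulate; allFin)
open import Data.List.Properties using (map-cong; map-tabulate)
open import Data.Nat using (ℕ; zero; suc; _+_; _*_; _∸_; _≤_; _<_; _<ᵇ_; _≡ᵇ_; z≤n; s≤s; z<s)
open import Data.Nat.ListAction using (sum)
open import Data.Nat.Properties
  using ( suc-injective; ≤-refl; ≤-reflexive; ≤-trans; ≤-antisym; <-trans; <-irrefl; <⇒≤; <⇒≢; >⇒≢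
        ; ≮⇒≥; n≤1+n; _<?_; +-comm; +-identityʳ; *-identityʳ; *-zeroʳ; +-mono-≤; +-monoˡ-≤
        ; +-cancelˡ-≡; +-cancelˡ-≤; m+[n∸m]≡n; m+n∸m≡n; +-commutativeSemigroup; module ≤-Reasoning )
  renaming (_≟_ to _≟ℕ_)
open import Data.Nat.Tactic.RingSolver using (solve-∀)
open import Data.Product using (Σ; ∃; _×_; _,_; proj₁; proj₂)
open import Function using (_∘_)
open import Function.Bundles using (Injection; mk⇔)
open import Function.Properties.Inverse using (↔⇒↣)
open import Relation.Binary.Definitions using (DecidableEquality)
open import Relation.Binary.PropositionalEquality
open import Relation.Nullary using (¬_; Dec; yes; no; does)
open import Relation.Nullary.Decidable using (dec-true; dec-false; does-⇔)

does⇒ : {A : Set} (a? : Dec A) → does a? ≡ true → A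
does⇒ (yes a) _ = a

does⇒¬ : {A : Set} (a? : Dec A) → does a? ≡ false → ¬ A
does⇒¬ (no ¬a) _ = ¬a

toℕ-≡ᵇ : {n : ℕ} (i j : Fin n) → (toℕ i ≡ᵇ toℕ j) ≡ does (i ≟ j)
toℕ-≡ᵇ zero    zero    = refl
toℕ-≡ᵇ zero    (suc j) = refl
toℕ-≡ᵇ (suc i) zero    = refl
toℕ-≡ᵇ (suc i) (suc j) = toℕ-≡ᵇ i j

-- Counting

𝟙 : Bool → ℕ
𝟙 b = if b then 1 else 0

𝟙-mono : {a b : Bool} → (a ≡ true → b ≡ true) → 𝟙 a ≤ 𝟙 b
𝟙-mono {false} _   = z≤n
𝟙-mono {true}  a⇒b rewrite a⇒b refl = ≤-refl

count-cong : {n : ℕ} {p q : Fin n → Bool} → (∀ i → p i ≡ q i) → count p ≡ count q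
count-cong {n} p≗q = cong sum (map-cong (cong 𝟙 ∘ p≗q) (allFin n))

count-suc : {n : ℕ} (p : Fin (suc n) → Bool) → count p ≡ 𝟙 (p zero) + count (p ∘ suc)
count-suc p = trans (count-tabulate p) (cong (𝟙 (p zero) +_) (sym (count-tabulate (p ∘ suc))))
  where
  count-tabulate : {n : ℕ} (p : Fin n → Bool) → count p ≡ sum (tabulate (𝟙 ∘ p))
  count-tabulate p = cong sum (map-tabulate (λ i → i) (𝟙 ∘ p))

count-≤ : {n : ℕ} (p : Fin n → Bool) → count p ≤ n
count-≤ {zero}  p = z≤n
count-≤ {suc n} p = begin
  count p                      ≡⟨ count-suc p ⟩
  𝟙 (p zero) + count (p ∘ suc) ≤⟨ +-mono-≤ (𝟙≤1 (p zero)) (count-≤ (p ∘ suc)) ⟩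
  suc n                        ∎
  where
  open ≤-Reasoning
  𝟙≤1 : ∀ b → 𝟙 b ≤ 1
  𝟙≤1 true  = s≤s z≤n
  𝟙≤1 false = z≤n

count-true : {n : ℕ} → count {n} (λ _ → true) ≡ n
count-true {zero}  = refl
count-true {suc n} = trans (count-suc {n} (λ _ → true)) (cong suc count-true)

count-none : {n : ℕ} (p : Fin n → Bool) → (∀ i → p i ≡ false) → count p ≡ 0
count-none {zero}  p none = refl
count-none {suc n} p none =
  trans (count-suc p) (cong₂ _+_ (cong 𝟙 (none zero)) (count-none (p ∘ suc) (none ∘ suc)))

count≡n⇒all : {n : ℕ} (p : Fin n → Bool) → count p ≡ n → ∀ i → p i ≡ true
count≡n⇒all {suc n} p count≡n = all-true (trans (sym (count-suc p)) count≡n)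
  where
  all-true : 𝟙 (p zero) + count (p ∘ suc) ≡ suc n → ∀ i → p i ≡ true
  all-true split≡n i with p zero in p₀
  all-true split≡n zero    | true  = p₀
  all-true split≡n (suc i) | true  = count≡n⇒all (p ∘ suc) (suc-injective split≡n) i
  all-true split≡n i       | false = ⊥-elim (<-irrefl split≡n (s≤s (count-≤ (p ∘ suc))))

count-witness : {n : ℕ} (p : Fin n → Bool) → 0 < count p → ∃ λ i → p i ≡ true
count-witness {suc n} p 0<count = witness (subst (0 <_) (count-suc p) 0<count)
  where
  witness : 0 < 𝟙 (p zero) + count (p ∘ suc) → ∃ λ i → p i ≡ true
  witness 0<split with p zero in p₀
  ... | true  = zero , p₀
  ... | false = let (i , pi) = count-witness (p ∘ suc) 0<split in suc i , pi

count-punchIn : {n : ℕ} (k : Fin (suc n)) (p : Fin (suc n) → Bool) →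
  count p ≡ 𝟙 (p k) + count (p ∘ punchIn k)
count-punchIn zero p = count-suc p
count-punchIn {suc n} (suc k) p = begin
  count p                                                      ≡⟨ count-suc p ⟩
  𝟙 (p zero) + count (p ∘ suc)                                 ≡⟨ cong (𝟙 (p zero) +_) (count-punchIn k (p ∘ suc)) ⟩
  𝟙 (p zero) + (𝟙 (p (suc k)) + count (p ∘ suc ∘ punchIn k))  ≡⟨ x∙yz≈y∙xz +-commutativeSemigroup (𝟙 (p zero)) (𝟙 (p (suc k))) _ ⟩
  𝟙 (p (suc k)) + (𝟙 (p zero) + count (p ∘ suc ∘ punchIn k))  ≡⟨ cong (𝟙 (p (suc k)) +_) (count-suc (p ∘ punchIn (suc k))) ⟨
  𝟙 (p (suc k)) + count (p ∘ punchIn (suc k))                  ∎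
  where open ≡-Reasoning

count-all-but-one : {n : ℕ} (p : Fin (suc n) → Bool) {k j : Fin (suc n)} →
  count p ≡ n → p k ≡ false → j ≢ k → p j ≡ true
count-all-but-one {n} p {k} {j} count≡n pk≡false j≢k =
  subst (λ x → p x ≡ true) (punchIn-punchOut (j≢k ∘ sym))
    (count≡n⇒all (p ∘ punchIn k) count-rest (punchOut (j≢k ∘ sym)))
  where
  open ≡-Reasoning
  count-rest : count (p ∘ punchIn k) ≡ n
  count-rest = begin
    count (p ∘ punchIn k)            ≡⟨ cong (λ b → 𝟙 b + count (p ∘ punchIn k)) pk≡false ⟨
    𝟙 (p k) + count (p ∘ punchIn k)  ≡⟨ count-punchIn k p ⟨
    count p                          ≡⟨ count≡n ⟩
    n                                ∎

count-singleton : {n : ℕ} (k : Fin n) → count (λ i → does (i ≟ k)) ≡ 1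
count-singleton {suc n} k = begin
  count (λ i → does (i ≟ k))                               ≡⟨ count-punchIn k (λ i → does (i ≟ k)) ⟩
  𝟙 (does (k ≟ k)) + count (λ i → does (punchIn k i ≟ k))  ≡⟨ cong₂ _+_ (cong 𝟙 (dec-true (k ≟ k) refl))
                                                               (count-none _ λ i → dec-false (punchIn k i ≟ k) (punchInᵢ≢i k i)) ⟩
  1                                                        ∎
  where open ≡-Reasoning

count-<ᵇ : {n m : ℕ} → m ≤ n → count {n} (λ i → toℕ i <ᵇ m) ≡ m
count-<ᵇ {n}     {zero}  _         = count-none {n} (λ i → toℕ i <ᵇ 0) λ _ → refl
count-<ᵇ {suc n} {suc m} (s≤s m≤n) = trans (count-suc {n} (λ i → toℕ i <ᵇ suc m)) (cong suc (count-<ᵇ m≤n))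

_⊆_ : {n : ℕ} → (Fin n → Bool) → (Fin n → Bool) → Set
p ⊆ q = ∀ i → p i ≡ true → q i ≡ true

count-mono : {n : ℕ} (p q : Fin n → Bool) → p ⊆ q → count p ≤ count q
count-mono {zero}  p q p⊆q = z≤n
count-mono {suc n} p q p⊆q = begin
  count p                      ≡⟨ count-suc p ⟩
  𝟙 (p zero) + count (p ∘ suc) ≤⟨ +-mono-≤ (𝟙-mono (p⊆q zero)) (count-mono (p ∘ suc) (q ∘ suc) (p⊆q ∘ suc)) ⟩
  𝟙 (q zero) + count (q ∘ suc) ≡⟨ count-suc q ⟨
  count q                      ∎
  where open ≤-Reasoning

⊆-count-antisym : {n : ℕ} (p q : Fin n → Bool) → p ⊆ q → count q ≤ count p → q ⊆ p
⊆-count-antisym {suc n} p q p⊆q q≤p = λ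
  { zero    → head split-≤
  ; (suc i) → ⊆-count-antisym (p ∘ suc) (q ∘ suc) (p⊆q ∘ suc) tail-≤ i }
  where
  split-≤ : 𝟙 (q zero) + count (q ∘ suc) ≤ 𝟙 (p zero) + count (p ∘ suc)
  split-≤ = subst₂ _≤_ (count-suc q) (count-suc p) q≤p
  tail-≤ : count (q ∘ suc) ≤ count (p ∘ suc)
  tail-≤ = +-cancelˡ-≤ (𝟙 (q zero)) _ _ (≤-trans split-≤ (+-monoˡ-≤ _ (𝟙-mono (p⊆q zero))))
  head : 𝟙 (q zero) + count (q ∘ suc) ≤ 𝟙 (p zero) + count (p ∘ suc) → q zero ≡ true → p zero ≡ true
  head split≤ q₀ with p zero | q zero
  ... | true  | _    = refl
  ... | false | true = ⊥-elim (<-irrefl refl (≤-trans split≤ (count-mono (p ∘ suc) (q ∘ suc) (p⊆q ∘ suc))))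

-- Loopless graphs

module _ {n : ℕ} (G : Graph (suc n)) (G-irrefl : ∀ i → G i i ≡ false) where

  degree-punchIn : ∀ i → degree G i ≡ count (G i ∘ punchIn i)
  degree-punchIn i = trans (count-punchIn i (G i)) (cong (λ b → 𝟙 b + count (G i ∘ punchIn i)) (G-irrefl i))

  adjacent-to-all : ∀ {i j} → degree G i ≡ n → j ≢ i → G i j ≡ true
  adjacent-to-all {i} degree≡n = count-all-but-one (G i) degree≡n (G-irrefl i)

  adjacent-to-all-but : ∀ {i k j} → suc (degree G i) ≡ n → G i k ≡ false →
    k ≢ i → j ≢ i → j ≢ k → G i j ≡ true
  adjacent-to-all-but {i} {k} {j} degree≡n Gik≡false k≢i j≢i j≢k = begin
    G i j          ≡⟨ ∨-identityʳ (G i j) ⟨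
    G i j ∨ false  ≡⟨ cong (G i j ∨_) (dec-false (j ≟ i) j≢i) ⟨
    closedNbhd j   ≡⟨ count-all-but-one closedNbhd count-closedNbhd closedNbhd-k j≢k ⟩
    true           ∎
    where
    open ≡-Reasoning
    closedNbhd : Fin (suc n) → Bool
    closedNbhd x = G i x ∨ does (x ≟ i)
    closedNbhd-k : closedNbhd k ≡ false
    closedNbhd-k = cong₂ _∨_ Gik≡false (dec-false (k ≟ i) k≢i)
    count-closedNbhd : count closedNbhd ≡ n
    count-closedNbhd = begin
      count closedNbhd                                   ≡⟨ count-punchIn i closedNbhd ⟩
      𝟙 (closedNbhd i) + count (closedNbhd ∘ punchIn i)  ≡⟨ cong₂ _+_ (cong 𝟙 (cong₂ _∨_ (G-irrefl i) (dec-true (i ≟ i) refl)))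
                                                              (count-cong λ x → trans (cong (G i (punchIn i x) ∨_)
                                                                (dec-false (punchIn i x ≟ i) (punchInᵢ≢i i x))) (∨-identityʳ _)) ⟩
      suc (count (G i ∘ punchIn i))                      ≡⟨ cong suc (degree-punchIn i) ⟨
      suc (degree G i)                                   ≡⟨ degree≡n ⟩
      n                                                  ∎

Simple-resp-≗ : {n : ℕ} {G H : Graph n} → (∀ i j → G i j ≡ H i j) → Simple H → Simple G
Simple-resp-≗ G≗H (H-sym , H-irrefl) =
  (λ i j → trans (G≗H i j) (trans (H-sym i j) (sym (G≗H j i)))) , (λ i → trans (G≗H i i) (H-irrefl i))

-- Graphs determined by a vertex colouring

colourGraph : {C : Set} {n : ℕ} → (C → C → Bool) → (Fin n → C) → Graph n
colourGraph adj c i j = not (does (i ≟ j)) ∧ adj (c i) (c j)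

module _ {C : Set} (adj : C → C → Bool) {n : ℕ} (c : Fin n → C) where

  colourGraph-irrefl : ∀ i → colourGraph adj c i i ≡ false
  colourGraph-irrefl i = cong (λ b → not b ∧ adj (c i) (c i)) (dec-true (i ≟ i) refl)

  colourGraph-simple : (∀ x y → adj x y ≡ adj y x) → Simple (colourGraph adj c)
  colourGraph-simple adj-sym =
      (λ i j → cong₂ (λ b a → not b ∧ a) (does-⇔ (mk⇔ sym sym) (i ≟ j) (j ≟ i)) (adj-sym (c i) (c j)))
    , colourGraph-irrefl

  ≗colourGraph : {G : Graph n} → (∀ i → G i i ≡ false) →
    (∀ i j → i ≢ j → G i j ≡ adj (c i) (c j)) → ∀ i j → G i j ≡ colourGraph adj c i j
  ≗colourGraph G-irrefl G-off i j with i ≟ j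
  ... | yes refl = G-irrefl i
  ... | no i≢j   = G-off i j i≢j

degree-colourGraph : {C : Set} (adj : C → C → Bool) {n : ℕ} (c : Fin (suc n) → C) (i : Fin (suc n)) →
  𝟙 (adj (c i) (c i)) + degree (colourGraph adj c) i ≡ count (λ j → adj (c i) (c j))
degree-colourGraph adj c i = begin
  𝟙 (adj (c i) (c i)) + degree (colourGraph adj c) i               ≡⟨ cong (𝟙 (adj (c i) (c i)) +_) degree≡ ⟩
  𝟙 (adj (c i) (c i)) + count (λ x → adj (c i) (c (punchIn i x)))  ≡⟨ count-punchIn i _ ⟨
  count (λ j → adj (c i) (c j))                                    ∎
  where
  open ≡-Reasoning
  degree≡ : degree (colourGraph adj c) i ≡ count (λ x → adj (c i) (c (punchIn i x)))
  degree≡ = trans (degree-punchIn (colourGraph adj c) (colourGraph-irrefl adj c) i)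
    (count-cong λ x → cong (λ b → not b ∧ adj (c i) (c (punchIn i x)))
                        (dec-false (i ≟ punchIn i x) (punchInᵢ≢i i x ∘ sym)))

module Colouring {C : Set} (_≟ᶜ_ : DecidableEquality C) where

  classSize : {n : ℕ} → (Fin n → C) → C → ℕ
  classSize c x = count (λ i → does (c i ≟ᶜ x))

  classSize-≡⇒permutation : {n : ℕ} (c d : Fin n → C) → (∀ x → classSize c x ≡ classSize d x) →
    Σ (Permutation′ n) λ σ → ∀ i → d (σ ⟨$⟩ʳ i) ≡ c i
  classSize-≡⇒permutation {zero}  c d sizes = Permutation.id , λ ()
  classSize-≡⇒permutation {suc n} c d sizes with count-witness (λ i → does (d i ≟ᶜ c zero)) 0<classSize
    where
    0<classSize : 0 < classSize d (c zero)
    0<classSize = begin-strict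
      0                                                  <⟨ z<s ⟩
      1 + classSize (c ∘ suc) (c zero)                   ≡⟨ cong (λ b → 𝟙 b + classSize (c ∘ suc) (c zero)) (dec-true (c zero ≟ᶜ c zero) refl) ⟨
      𝟙 (does (c zero ≟ᶜ c zero)) + classSize (c ∘ suc) (c zero)
                                                         ≡⟨ count-suc (λ i → does (c i ≟ᶜ c zero)) ⟨
      classSize c (c zero)                               ≡⟨ sizes (c zero) ⟩
      classSize d (c zero)                               ∎
      where open ≤-Reasoning
  ... | k , dk≟c₀ with classSize-≡⇒permutation (c ∘ suc) (d ∘ punchIn k) sizes-rest
    where
    dk≡c₀ : d k ≡ c zero
    dk≡c₀ = does⇒ (d k ≟ᶜ c zero) dk≟c₀
    sizes-rest : ∀ y → classSize (c ∘ suc) y ≡ classSize (d ∘ punchIn k) y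
    sizes-rest y = +-cancelˡ-≡ (𝟙 (does (c zero ≟ᶜ y))) _ _ (begin
      𝟙 (does (c zero ≟ᶜ y)) + classSize (c ∘ suc) y       ≡⟨ count-suc (λ i → does (c i ≟ᶜ y)) ⟨
      classSize c y                                       ≡⟨ sizes y ⟩
      classSize d y                                       ≡⟨ count-punchIn k (λ i → does (d i ≟ᶜ y)) ⟩
      𝟙 (does (d k ≟ᶜ y)) + classSize (d ∘ punchIn k) y   ≡⟨ cong (λ x → 𝟙 (does (x ≟ᶜ y)) + classSize (d ∘ punchIn k) y) dk≡c₀ ⟩
      𝟙 (does (c zero ≟ᶜ y)) + classSize (d ∘ punchIn k) y ∎)
      where open ≡-Reasoning
  ... | π , dπ≗c = insert zero k π , λ
    { zero    → does⇒ (d k ≟ᶜ c zero) dk≟c₀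
    ; (suc i) → trans (cong d (insert-punchIn zero k π i)) (dπ≗c i) }

  colourGraph-≅ : {n : ℕ} {G H : Graph n} (adj : C → C → Bool) (c d : Fin n → C) →
    (∀ i j → G i j ≡ colourGraph adj c i j) → (∀ i j → H i j ≡ colourGraph adj d i j) →
    (∀ x → classSize c x ≡ classSize d x) → G ≅ H
  colourGraph-≅ {G = G} {H} adj c d G≗ H≗ sizes with classSize-≡⇒permutation c d sizes
  ... | σ , dσ≗c = σ , λ i j → begin
    H (σ ⟨$⟩ʳ i) (σ ⟨$⟩ʳ j)                                               ≡⟨ H≗ (σ ⟨$⟩ʳ i) (σ ⟨$⟩ʳ j) ⟩
    not (does (σ ⟨$⟩ʳ i ≟ σ ⟨$⟩ʳ j)) ∧ adj (d (σ ⟨$⟩ʳ i)) (d (σ ⟨$⟩ʳ j))  ≡⟨ cong₂ (λ b a → not b ∧ a) (σ-preserves-≟ i j)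
                                                                               (cong₂ adj (dσ≗c i) (dσ≗c j)) ⟩
    colourGraph adj c i j                                                 ≡⟨ G≗ i j ⟨
    G i j                                                                 ∎
    where
    open ≡-Reasoning
    σ-preserves-≟ : ∀ i j → does (σ ⟨$⟩ʳ i ≟ σ ⟨$⟩ʳ j) ≡ does (i ≟ j)
    σ-preserves-≟ i j =
      does-⇔ (mk⇔ (Injection.injective (↔⇒↣ σ)) (cong (σ ⟨$⟩ʳ_))) (σ ⟨$⟩ʳ i ≟ σ ⟨$⟩ʳ j) (i ≟ j)

-- The role of v_i is v≤δ or v>δ according as i ≤ δ or i > δ; the role of w is w.
data Role : Set where
  v≤δ v>δ w : Role

_≟ᴿ_ : DecidableEquality Role
v≤δ ≟ᴿ v≤δ = yes refl
v≤δ ≟ᴿ v>δ = no λ ()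
v≤δ ≟ᴿ w   = no λ ()
v>δ ≟ᴿ v≤δ = no λ ()
v>δ ≟ᴿ v>δ = yes refl
v>δ ≟ᴿ w   = no λ ()
w   ≟ᴿ v≤δ = no λ ()
w   ≟ᴿ v>δ = no λ ()
w   ≟ᴿ w   = yes refl

_==_ : Role → Role → Bool
r == s = does (r ≟ᴿ s)

linked : Role → Role → Bool
linked r s = ((not (r == w) ∧ not (s == w)) ∨ ((r == w) ∧ (s == v≤δ))) ∨ ((s == w) ∧ (r == v≤δ))

linked-sym : ∀ r s → linked r s ≡ linked s r
linked-sym v≤δ v≤δ = refl
linked-sym v≤δ v>δ = refl
linked-sym v≤δ w   = refl
linked-sym v>δ v≤δ = refl
linked-sym v>δ v>δ = refl
linked-sym v>δ w   = refl
linked-sym w   v≤δ = refl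
linked-sym w   v>δ = refl
linked-sym w   w   = refl

open Colouring _≟ᴿ_

count-by-role : {n : ℕ} (f : Role → Bool) (c : Fin n → Role) →
  count (f ∘ c) ≡ classSize c v≤δ * 𝟙 (f v≤δ) + classSize c v>δ * 𝟙 (f v>δ) + classSize c w * 𝟙 (f w)
count-by-role {zero}  f c = refl
count-by-role {suc n} f c = begin
  count (f ∘ c)                                          ≡⟨ count-suc (f ∘ c) ⟩
  𝟙 (f (c zero)) + count (f ∘ c ∘ suc)                   ≡⟨ cong₂ _+_ (𝟙-by-role (c zero)) (count-by-role f (c ∘ suc)) ⟩
  (e v≤δ * a + e v>δ * b + e w * d) + (s v≤δ * a + s v>δ * b + s w * d)
                                                         ≡⟨ regroup (e v≤δ) (e v>δ) (e w) (s v≤δ) (s v>δ) (s w) a b d ⟩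
  (e v≤δ + s v≤δ) * a + (e v>δ + s v>δ) * b + (e w + s w) * d
                                                         ≡⟨ cong₂ _+_ (cong₂ _+_ (cong (_* a) (count-suc (λ i → c i == v≤δ)))
                                                                                (cong (_* b) (count-suc (λ i → c i == v>δ))))
                                                                      (cong (_* d) (count-suc (λ i → c i == w))) ⟨
  classSize c v≤δ * a + classSize c v>δ * b + classSize c w * d  ∎
  where
  open ≡-Reasoning
  a b d : ℕ
  a = 𝟙 (f v≤δ)
  b = 𝟙 (f v>δ)
  d = 𝟙 (f w)
  e s : Role → ℕ
  e x = 𝟙 (c zero == x)
  s = classSize (c ∘ suc)
  𝟙-by-role : ∀ r → 𝟙 (f r) ≡ 𝟙 (r == v≤δ) * a + 𝟙 (r == v>δ) * b + 𝟙 (r == w) * d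
  𝟙-by-role v≤δ = sym (trans (+-identityʳ _) (trans (+-identityʳ _) (+-identityʳ a)))
  𝟙-by-role v>δ = sym (trans (+-identityʳ _) (+-identityʳ b))
  𝟙-by-role w   = sym (+-identityʳ d)
  regroup : ∀ e₁ e₂ e₃ s₁ s₂ s₃ a b d →
    (e₁ * a + e₂ * b + e₃ * d) + (s₁ * a + s₂ * b + s₃ * d) ≡ (e₁ + s₁) * a + (e₂ + s₂) * b + (e₃ + s₃) * d
  regroup = solve-∀

-- Graphs with the role counts of H_{δ,Δ}

module ℋ (δ Δ : ℕ) (δ<Δ : δ < Δ) where

  roleSize : Role → ℕ
  roleSize v≤δ = δ
  roleSize v>δ = Δ ∸ δ
  roleSize w   = 1

  roleDegree : Role → ℕ
  roleDegree v≤δ = Δ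
  roleDegree v>δ = Δ ∸ 1
  roleDegree w   = δ

  suc[Δ∸1]≡Δ : suc (Δ ∸ 1) ≡ Δ
  suc[Δ∸1]≡Δ = m+[n∸m]≡n (≤-trans (s≤s z≤n) δ<Δ)

  Δ∸1<Δ : Δ ∸ 1 < Δ
  Δ∸1<Δ = ≤-reflexive suc[Δ∸1]≡Δ

  δ+[Δ∸δ]≡Δ : δ * 1 + (Δ ∸ δ) * 1 ≡ Δ
  δ+[Δ∸δ]≡Δ = trans (cong₂ _+_ (*-identityʳ δ) (*-identityʳ (Δ ∸ δ))) (m+[n∸m]≡n (<⇒≤ δ<Δ))

  classSize-v>δ : (c : Fin (suc Δ) → Role) → classSize c v≤δ ≡ δ → classSize c w ≡ 1 → classSize c v>δ ≡ Δ ∸ δ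
  classSize-v>δ c size-v≤δ size-w = begin
    classSize c v>δ          ≡⟨ m+n∸m≡n δ _ ⟨
    δ + classSize c v>δ ∸ δ  ≡⟨ cong (_∸ δ) δ+size≡Δ ⟩
    Δ ∸ δ                    ∎
    where
    open ≡-Reasoning
    δ+size≡Δ : δ + classSize c v>δ ≡ Δ
    δ+size≡Δ = suc-injective (begin
      suc (δ + classSize c v>δ)                                       ≡⟨ +-comm 1 _ ⟩
      δ + classSize c v>δ + 1                                         ≡⟨ cong₂ (λ a b → a + classSize c v>δ + b) size-v≤δ size-w ⟨
      classSize c v≤δ + classSize c v>δ + classSize c w               ≡⟨ cong₂ _+_ (cong₂ _+_ (*-identityʳ (classSize c v≤δ))
                                                                                              (*-identityʳ (classSize c v>δ)))
                                                                                    (*-identityʳ (classSize c w)) ⟨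
      classSize c v≤δ * 1 + classSize c v>δ * 1 + classSize c w * 1   ≡⟨ count-by-role (λ _ → true) c ⟨
      count {suc Δ} (λ _ → true)                                      ≡⟨ count-true ⟩
      suc Δ                                                           ∎)

  In-ℋ-resp-≗ : {G H : Graph (suc Δ)} → (∀ i j → G i j ≡ H i j) → In-ℋ δ Δ H → In-ℋ δ Δ G
  In-ℋ-resp-≗ {G} {H} G≗H (u , degree-u , count-Δ , count-Δ∸1) =
      u
    , trans (degree≡ u) degree-u
    , trans (count-cong λ v → cong (_≡ᵇ Δ) (degree≡ v)) count-Δ
    , trans (count-cong λ v → cong (λ k → not (toℕ v ≡ᵇ toℕ u) ∧ (k ≡ᵇ Δ ∸ 1)) (degree≡ v)) count-Δ∸1
    where
    degree≡ : ∀ v → degree G v ≡ degree H v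
    degree≡ v = count-cong (G≗H v)

  module RoleGraph (c : Fin (suc Δ) → Role) (sizes : ∀ x → classSize c x ≡ roleSize x) where

    weighted-degree : ∀ i → 𝟙 (linked (c i) (c i)) + degree (colourGraph linked c) i ≡
      δ * 𝟙 (linked (c i) v≤δ) + (Δ ∸ δ) * 𝟙 (linked (c i) v>δ) + 1 * 𝟙 (linked (c i) w)
    weighted-degree i = begin
      𝟙 (linked (c i) (c i)) + degree (colourGraph linked c) i       ≡⟨ degree-colourGraph linked c i ⟩
      count (linked (c i) ∘ c)                                      ≡⟨ count-by-role (linked (c i)) c ⟩
      classSize c v≤δ * a + classSize c v>δ * b + classSize c w * d ≡⟨ cong₂ _+_ (cong₂ _+_ (cong (_* a) (sizes v≤δ))
                                                                                            (cong (_* b) (sizes v>δ)))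
                                                                                 (cong (_* d) (sizes w)) ⟩
      δ * a + (Δ ∸ δ) * b + 1 * d                                   ∎
      where
      open ≡-Reasoning
      a b d : ℕ
      a = 𝟙 (linked (c i) v≤δ)
      b = 𝟙 (linked (c i) v>δ)
      d = 𝟙 (linked (c i) w)

    degree-roleGraph : ∀ i → degree (colourGraph linked c) i ≡ roleDegree (c i)
    degree-roleGraph i with c i | weighted-degree i
    ... | v≤δ | d = suc-injective (trans d (trans (cong (_+ 1) δ+[Δ∸δ]≡Δ) (+-comm Δ 1)))
    ... | v>δ | d = cong (_∸ 1) (trans d (trans (+-identityʳ _) δ+[Δ∸δ]≡Δ))
    ... | w   | d = trans d (trans (+-identityʳ _) (trans (cong₂ _+_ (*-identityʳ δ) (*-zeroʳ (Δ ∸ δ))) (+-identityʳ δ)))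

    roleGraph-∈ℋ : (w₀ : Fin (suc Δ)) → (∀ v → (c v == w) ≡ does (v ≟ w₀)) → In-ℋ δ Δ (colourGraph linked c)
    roleGraph-∈ℋ w₀ c≡w⇔≡w₀ = w₀ , degree-w₀ , count-degree-Δ , count-degree-Δ∸1
      where
      open ≡-Reasoning
      G : Graph (suc Δ)
      G = colourGraph linked c
      degree-w₀ : degree G w₀ ≡ δ
      degree-w₀ = trans (degree-roleGraph w₀)
        (cong roleDegree (does⇒ (c w₀ ≟ᴿ w) (trans (c≡w⇔≡w₀ w₀) (dec-true (w₀ ≟ w₀) refl))))
      degree-Δ : ∀ r → (roleDegree r ≡ᵇ Δ) ≡ (r == v≤δ)
      degree-Δ v≤δ = dec-true (Δ ≟ℕ Δ) refl
      degree-Δ v>δ = dec-false (Δ ∸ 1 ≟ℕ Δ) (<⇒≢ Δ∸1<Δ)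
      degree-Δ w   = dec-false (δ ≟ℕ Δ) (<⇒≢ δ<Δ)
      degree-Δ∸1 : ∀ r → not (r == w) ∧ (roleDegree r ≡ᵇ Δ ∸ 1) ≡ (r == v>δ)
      degree-Δ∸1 v≤δ = dec-false (Δ ≟ℕ Δ ∸ 1) (>⇒≢ Δ∸1<Δ)
      degree-Δ∸1 v>δ = dec-true (Δ ∸ 1 ≟ℕ Δ ∸ 1) refl
      degree-Δ∸1 w   = refl
      count-degree-Δ : count (λ v → degree G v ≡ᵇ Δ) ≡ δ
      count-degree-Δ = begin
        count (λ v → degree G v ≡ᵇ Δ)  ≡⟨ count-cong (λ v → trans (cong (_≡ᵇ Δ) (degree-roleGraph v)) (degree-Δ (c v))) ⟩
        classSize c v≤δ               ≡⟨ sizes v≤δ ⟩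
        δ                             ∎
      count-degree-Δ∸1 : count (λ v → not (toℕ v ≡ᵇ toℕ w₀) ∧ (degree G v ≡ᵇ Δ ∸ 1)) ≡ Δ ∸ δ
      count-degree-Δ∸1 = begin
        count (λ v → not (toℕ v ≡ᵇ toℕ w₀) ∧ (degree G v ≡ᵇ Δ ∸ 1))
          ≡⟨ count-cong (λ v → trans (cong₂ (λ b k → not b ∧ (k ≡ᵇ Δ ∸ 1))
                                              (trans (toℕ-≡ᵇ v w₀) (sym (c≡w⇔≡w₀ v))) (degree-roleGraph v))
                                     (degree-Δ∸1 (c v))) ⟩
        classSize c v>δ
          ≡⟨ sizes v>δ ⟩
        Δ ∸ δ ∎

  roleOf : ℕ → Role
  roleOf a with a <? δ | a <? Δ
  ... | yes _ | _     = v≤δ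
  ... | no _  | yes _ = v>δ
  ... | no _  | no _  = w

  thresholds : ℕ → Bool × Bool × Bool
  thresholds a = (a <ᵇ δ) , (a <ᵇ Δ) , (a ≡ᵇ Δ)

  roleFlags : Role → Bool × Bool × Bool
  roleFlags r = (r == v≤δ) , not (r == w) , (r == w)

  thresholds≡roleFlags : ∀ {a} → a ≤ Δ → thresholds a ≡ roleFlags (roleOf a)
  thresholds≡roleFlags {a} a≤Δ with a <? δ | a <? Δ
  ... | yes a<δ | _       = cong₂ _,_ (dec-true (a <? δ) a<δ)
                              (cong₂ _,_ (dec-true (a <? Δ) (<-trans a<δ δ<Δ)) (dec-false (a ≟ℕ Δ) (<⇒≢ (<-trans a<δ δ<Δ))))
  ... | no a≮δ  | yes a<Δ = cong₂ _,_ (dec-false (a <? δ) a≮δ)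
                              (cong₂ _,_ (dec-true (a <? Δ) a<Δ) (dec-false (a ≟ℕ Δ) (<⇒≢ a<Δ)))
  ... | no a≮δ  | no a≮Δ  = cong₂ _,_ (dec-false (a <? δ) a≮δ)
                              (cong₂ _,_ (dec-false (a <? Δ) a≮Δ) (dec-true (a ≟ℕ Δ) (≤-antisym a≤Δ (≮⇒≥ a≮Δ))))

  roleᴴ : Fin (suc Δ) → Role
  roleᴴ i = roleOf (toℕ i)

  thresholds≡roleFlagsᴴ : ∀ i → thresholds (toℕ i) ≡ roleFlags (roleᴴ i)
  thresholds≡roleFlagsᴴ i = thresholds≡roleFlags (toℕ≤pred[n] i)

  H-graph≗ : ∀ i j → H-graph δ Δ i j ≡ colourGraph linked roleᴴ i j
  H-graph≗ i j = cong₂ (λ b a → not b ∧ a) (toℕ-≡ᵇ i j)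
                   (cong₂ rule (thresholds≡roleFlagsᴴ i) (thresholds≡roleFlagsᴴ j))
    where
    rule : Bool × Bool × Bool → Bool × Bool × Bool → Bool
    rule (a₁ , a₂ , a₃) (b₁ , b₂ , b₃) = ((a₂ ∧ b₂) ∨ (a₃ ∧ b₁)) ∨ (b₃ ∧ a₁)

  roleᴴ-w : ∀ i → (roleᴴ i == w) ≡ does (i ≟ fromℕ Δ)
  roleᴴ-w i = begin
    roleᴴ i == w            ≡⟨ cong (proj₂ ∘ proj₂) (thresholds≡roleFlagsᴴ i) ⟨
    toℕ i ≡ᵇ Δ              ≡⟨ cong (toℕ i ≡ᵇ_) (toℕ-fromℕ Δ) ⟨
    toℕ i ≡ᵇ toℕ (fromℕ Δ)  ≡⟨ toℕ-≡ᵇ i (fromℕ Δ) ⟩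
    does (i ≟ fromℕ Δ)      ∎
    where open ≡-Reasoning

  sizeᴴ-v≤δ : classSize roleᴴ v≤δ ≡ δ
  sizeᴴ-v≤δ = trans (count-cong λ i → sym (cong proj₁ (thresholds≡roleFlagsᴴ i)))
                    (count-<ᵇ (≤-trans (<⇒≤ δ<Δ) (n≤1+n Δ)))

  sizeᴴ-w : classSize roleᴴ w ≡ 1
  sizeᴴ-w = trans (count-cong roleᴴ-w) (count-singleton (fromℕ Δ))

  sizesᴴ : ∀ x → classSize roleᴴ x ≡ roleSize x
  sizesᴴ v≤δ = sizeᴴ-v≤δ
  sizesᴴ v>δ = classSize-v>δ roleᴴ sizeᴴ-v≤δ sizeᴴ-w
  sizesᴴ w   = sizeᴴ-w

  H-simple : Simple (H-graph δ Δ)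
  H-simple = Simple-resp-≗ H-graph≗ (colourGraph-simple linked roleᴴ linked-sym)

  H-∈ℋ : In-ℋ δ Δ (H-graph δ Δ)
  H-∈ℋ = In-ℋ-resp-≗ H-graph≗ (RoleGraph.roleGraph-∈ℋ roleᴴ sizesᴴ (fromℕ Δ) roleᴴ-w)

  module Uniqueness (G : Graph (suc Δ)) (G-simple : Simple G) (u : Fin (suc Δ)) (degree-u : degree G u ≡ δ)
    (count-full : count (λ v → degree G v ≡ᵇ Δ) ≡ δ)
    (count-partial : count (λ v → not (toℕ v ≡ᵇ toℕ u) ∧ (degree G v ≡ᵇ Δ ∸ 1)) ≡ Δ ∸ δ) where

    G-sym : ∀ i j → G i j ≡ G j i
    G-sym = proj₁ G-simple

    G-irrefl : ∀ i → G i i ≡ false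
    G-irrefl = proj₂ G-simple

    full : Fin (suc Δ) → Bool
    full v = degree G v ≡ᵇ Δ

    partial : Fin (suc Δ) → Bool
    partial v = not (toℕ v ≡ᵇ toℕ u) ∧ (degree G v ≡ᵇ Δ ∸ 1)

    u-not-full : full u ≡ false
    u-not-full = dec-false (degree G u ≟ℕ Δ) (<⇒≢ δ<Δ ∘ trans (sym degree-u))

    full⇒adjacent-u : full ⊆ G u
    full⇒adjacent-u j full-j = trans (G-sym u j) (adjacent-to-all G G-irrefl degree-j u≢j)
      where
      degree-j : degree G j ≡ Δ
      degree-j = does⇒ (degree G j ≟ℕ Δ) full-j
      u≢j : u ≢ j
      u≢j refl = <⇒≢ δ<Δ (trans (sym degree-u) degree-j)

    -- u is adjacent to every full vertex and has exactly as many neighbours as there are full vertices.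
    adjacent-u⇒full : G u ⊆ full
    adjacent-u⇒full = ⊆-count-antisym full (G u) full⇒adjacent-u (≤-reflexive (trans degree-u (sym count-full)))

    non-adjacent-u : ∀ {v} → degree G v ≢ Δ → G u v ≡ false
    non-adjacent-u {v} degree≢Δ with G u v in adjacent
    ... | true  = ⊥-elim (degree≢Δ (does⇒ (degree G v ≟ℕ Δ) (adjacent-u⇒full v adjacent)))
    ... | false = refl

    roleᴳ : Fin (suc Δ) → Role
    roleᴳ v with v ≟ u | full v
    ... | yes _ | _     = w
    ... | no _  | true  = v≤δ
    ... | no _  | false = v>δ

    roleᴳ-w : ∀ v → (roleᴳ v == w) ≡ does (v ≟ u)
    roleᴳ-w v with v ≟ u | full v
    ... | yes _ | _     = refl
    ... | no _  | true  = refl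
    ... | no _  | false = refl

    roleᴳ-v≤δ : ∀ v → (roleᴳ v == v≤δ) ≡ full v
    roleᴳ-v≤δ v with v ≟ u | full v in full-v
    ... | yes refl | _     = trans (sym u-not-full) full-v
    ... | no _     | true  = refl
    ... | no _     | false = refl

    roleᴳ-v>δ : ∀ v → (roleᴳ v == v>δ) ≡ not (does (v ≟ u)) ∧ not (full v)
    roleᴳ-v>δ v with v ≟ u | full v
    ... | yes _ | _     = refl
    ... | no _  | true  = refl
    ... | no _  | false = refl

    sizeᴳ-v≤δ : classSize roleᴳ v≤δ ≡ δ
    sizeᴳ-v≤δ = trans (count-cong roleᴳ-v≤δ) count-full

    sizeᴳ-w : classSize roleᴳ w ≡ 1
    sizeᴳ-w = trans (count-cong roleᴳ-w) (count-singleton u)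

    sizesᴳ : ∀ x → classSize roleᴳ x ≡ roleSize x
    sizesᴳ v≤δ = sizeᴳ-v≤δ
    sizesᴳ v>δ = classSize-v>δ roleᴳ sizeᴳ-v≤δ sizeᴳ-w
    sizesᴳ w   = sizeᴳ-w

    partial⇒≢u∧degree : ∀ {v} → partial v ≡ true → v ≢ u × degree G v ≡ Δ ∸ 1
    partial⇒≢u∧degree {v} partial-v with toℕ v ≡ᵇ toℕ u in toℕ-v≡ᵇtoℕ-u
    partial⇒≢u∧degree {v} () | true
    ... | false = does⇒¬ (v ≟ u) (trans (sym (toℕ-≡ᵇ v u)) toℕ-v≡ᵇtoℕ-u) , does⇒ (degree G v ≟ℕ Δ ∸ 1) partial-v

    partial⊆v>δ : partial ⊆ (λ v → roleᴳ v == v>δ)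
    partial⊆v>δ v partial-v = trans (roleᴳ-v>δ v) (cong₂ (λ a b → not a ∧ not b)
      (dec-false (v ≟ u) v≢u) (dec-false (degree G v ≟ℕ Δ) (<⇒≢ Δ∸1<Δ ∘ trans (sym degree-v))))
      where
      v≢u : v ≢ u
      v≢u = proj₁ (partial⇒≢u∧degree partial-v)
      degree-v : degree G v ≡ Δ ∸ 1
      degree-v = proj₂ (partial⇒≢u∧degree partial-v)

    -- Both sets have Δ − δ elements.
    v>δ⊆partial : (λ v → roleᴳ v == v>δ) ⊆ partial
    v>δ⊆partial = ⊆-count-antisym partial _ partial⊆v>δ (≤-reflexive (trans (sizesᴳ v>δ) (sym count-partial)))

    roleᴳ≡w⇒≡u : ∀ {v} → roleᴳ v ≡ w → v ≡ u
    roleᴳ≡w⇒≡u {v} eq = does⇒ (v ≟ u) (trans (sym (roleᴳ-w v)) (cong (_== w) eq))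

    roleᴳ≡v≤δ⇒degree : ∀ {v} → roleᴳ v ≡ v≤δ → degree G v ≡ Δ
    roleᴳ≡v≤δ⇒degree {v} eq = does⇒ (degree G v ≟ℕ Δ) (trans (sym (roleᴳ-v≤δ v)) (cong (_== v≤δ) eq))

    roleᴳ≡v>δ⇒≢u∧degree : ∀ {v} → roleᴳ v ≡ v>δ → v ≢ u × degree G v ≡ Δ ∸ 1
    roleᴳ≡v>δ⇒≢u∧degree {v} eq = partial⇒≢u∧degree (v>δ⊆partial v (cong (_== v>δ) eq))

    full-adjacent : ∀ {i j} → roleᴳ i ≡ v≤δ → j ≢ i → G i j ≡ true
    full-adjacent ri = adjacent-to-all G G-irrefl (roleᴳ≡v≤δ⇒degree ri)

    u-non-adjacent : ∀ {v} → roleᴳ v ≡ v>δ → G u v ≡ false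
    u-non-adjacent rv = non-adjacent-u (<⇒≢ Δ∸1<Δ ∘ trans (sym (proj₂ (roleᴳ≡v>δ⇒≢u∧degree rv))))

    partial-adjacent : ∀ {i j} → roleᴳ i ≡ v>δ → roleᴳ j ≡ v>δ → j ≢ i → G i j ≡ true
    partial-adjacent {i} ri rj j≢i = adjacent-to-all-but G G-irrefl
      (trans (cong suc (proj₂ (roleᴳ≡v>δ⇒≢u∧degree ri))) suc[Δ∸1]≡Δ)
      (trans (G-sym i u) (u-non-adjacent ri)) (proj₁ (roleᴳ≡v>δ⇒≢u∧degree ri) ∘ sym) j≢i
      (proj₁ (roleᴳ≡v>δ⇒≢u∧degree rj))

    off-diagonal : ∀ i j → i ≢ j → G i j ≡ linked (roleᴳ i) (roleᴳ j)
    off-diagonal i j i≢j with roleᴳ i in ri | roleᴳ j in rj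
    ... | w   | w   = ⊥-elim (i≢j (trans (roleᴳ≡w⇒≡u ri) (sym (roleᴳ≡w⇒≡u rj))))
    ... | w   | v≤δ = trans (G-sym i j) (full-adjacent rj i≢j)
    ... | w   | v>δ = trans (cong (λ x → G x j) (roleᴳ≡w⇒≡u ri)) (u-non-adjacent rj)
    ... | v≤δ | w   = full-adjacent ri (i≢j ∘ sym)
    ... | v≤δ | v≤δ = full-adjacent ri (i≢j ∘ sym)
    ... | v≤δ | v>δ = full-adjacent ri (i≢j ∘ sym)
    ... | v>δ | w   = trans (G-sym i j) (trans (cong (λ x → G x i) (roleᴳ≡w⇒≡u rj)) (u-non-adjacent ri))
    ... | v>δ | v≤δ = trans (G-sym i j) (full-adjacent rj i≢j)
    ... | v>δ | v>δ = partial-adjacent ri rj (i≢j ∘ sym)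

    G≗ : ∀ i j → G i j ≡ colourGraph linked roleᴳ i j
    G≗ = ≗colourGraph linked roleᴳ G-irrefl off-diagonal

proposition2p9 : (δ Δ : ℕ) → 1 ≤ δ → δ < Δ →
    (Simple (H-graph δ Δ) × In-ℋ δ Δ (H-graph δ Δ))
    × ((G : Graph (suc Δ)) → Simple G → In-ℋ δ Δ G → G ≅ H-graph δ Δ)
proposition2p9 δ Δ _ δ<Δ = (H-simple , H-∈ℋ) , unique
  where
  open ℋ δ Δ δ<Δ
  unique : (G : Graph (suc Δ)) → Simple G → In-ℋ δ Δ G → G ≅ H-graph δ Δ
  unique G G-simple (u , degree-u , count-full , count-partial) =
    colourGraph-≅ linked roleᴳ roleᴴ G≗ H-graph≗ λ x → trans (sizesᴳ x) (sym (sizesᴴ x))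
    where open Uniqueness G G-simple u degree-u count-full count-partial
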